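{- Let $t\ge 5$ and let $X_1,\dots,X_t$ be pairwise disjoint vertex subsets of $G_3$ with $V(G_3)=\bigcup_{i=1}^t X_i$ and $|X_1|\ge|X_2|\ge\cdots\ge|X_t|>0$. Then $\sum_{1\le i<j\le t}e(X_i,X_j)\ge 8$.
   Context: $G_3$ is the 3-dimensional locally twisted cube: vertex set $\{0,1\}^3$ and the 12 edges $000\text{ - }001$, $001\text{ - }011$, $011\text{ - }010$, $010\text{ - }000$, $100\text{ - }101$, $101\text{ - }111$, $111\text{ - }110$, $110\text{ - }100$, $000\text{ - }100$, $010\text{ - }110$, $001\text{ - }111$, $011\text{ - }101$ (a cubic graph). For vertex sets $X,Y$, $e(X,Y)$ is the number of edges with one end in $X$ and the other in $Y$. -}

module Defs where

open import Data.Nat using (ℕ; zero; suc; _+_; _<_)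
open import Data.Fin using (Fin; toℕ; #_)
open import Data.Fin.Subset using (Subset; _∈_; ∣_∣)
open import Data.Fin.Subset.Properties using (_∈?_)
open import Data.List using (List; []; _∷_; map; allFin)
open import Data.Nat.ListAction using (sum)
open import Data.Product using (_×_; _,_)
open import Data.Bool using (Bool; true; false; _∨_; _∧_)
open import Relation.Nullary.Decidable using (⌊_⌋)
open import Relation.Nullary using (yes; no)
open import Data.Nat using (_<?_)

-- Vertices of G₃: a bit string b₁b₂b₃ ∈ {0,1}³ is encoded as the Fin 8
-- element with binary value b₁b₂b₃ (e.g. 011 ↦ 3, 101 ↦ 5).
V : Set
V = Fin 8

-- The 12 edges of the 3-dimensional locally twisted cube G₃.
edges : List (V × V)
edges =
    (# 0 , # 1) ∷ (# 1 , # 3) ∷ (# 3 , # 2) ∷ (# 2 , # 0)        -- 000-001, 001-011, 011-010, 010-000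
  ∷ (# 4 , # 5) ∷ (# 5 , # 7) ∷ (# 7 , # 6) ∷ (# 6 , # 4)        -- 100-101, 101-111, 111-110, 110-100
  ∷ (# 0 , # 4) ∷ (# 2 , # 6) ∷ (# 1 , # 7) ∷ (# 3 , # 5) ∷ []   -- 000-100, 010-110, 001-111, 011-101

crosses : Subset 8 → Subset 8 → V × V → Bool
crosses X Y (u , v) =
  (⌊ u ∈? X ⌋ ∧ ⌊ v ∈? Y ⌋) ∨ (⌊ v ∈? X ⌋ ∧ ⌊ u ∈? Y ⌋)

count : {A : Set} → (A → Bool) → List A → ℕ
count p [] = 0
count p (a ∷ as) with p a
... | true  = suc (count p as)
... | false = count p as

e : Subset 8 → Subset 8 → ℕ
e X Y = count (crosses X Y) edges

sumPairs : {t : ℕ} → (Fin t → Fin t → ℕ) → ℕ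
sumPairs {t} f =
  sum (map (λ i → sum (map (λ j → g i j) (allFin t))) (allFin t))
  where
  g : Fin t → Fin t → ℕ
  g i j with toℕ i <? toℕ j
  ... | yes _ = f i j
  ... | no  _ = 0

module Submission where

-- Colour each vertex v of G₃ by the index c v of the part X_i containing it,
-- and call an edge cut when its ends get different colours.  A cut edge uv
-- is counted by the term e(X_{c u}, X_{c v}) (or e(X_{c v}, X_{c u})) of the
-- pair sum, so the pair sum is at least the number of cut edges.  Since there
-- are t ≥ 5 nonempty parts, five vertices receive pairwise distinct colours,
-- so the uncut edges leave G₃ with at least five connected components.  The
-- finite heart of the proof is that deleting at most 7 edges of G₃ leaves at
-- most 4 components.  It is certified by evaluating a search that, edge by
-- edge, either keeps the edge (merging the components of its ends in a
-- union–find labelling of the vertices) or deletes it (counting it), and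
-- checks at every one of the 2¹² leaves that at least 8 edges were deleted
-- or at most 4 labels remain.  Run along the colouring c, where labels keep
-- the colour of their vertex, the search can only end in the first case.

open import Defs
open import Data.Nat using (ℕ; _≤_; _<_; _≥_)
open import Data.Fin using (Fin; toℕ)
open import Data.Fin.Subset using (Subset; _∈_; ∣_∣)
open import Data.Product using (∃-syntax)
open import Relation.Binary.PropositionalEquality using (_≢_)
open import Data.Empty using (⊥; ⊥-elim)

open import Data.Nat using (suc; _+_; _≤ᵇ_; _<?_; z≤n)
open import Data.Nat.Properties
  using (+-commutativeSemigroup; +-suc; <⇒≱; ≤-trans; ≤-reflexive; m≤m+n; m≤n+m; +-mono-≤; ≤ᵇ⇒≤; <-cmp; <⇒≢; module ≤-Reasoning)
open import Data.Nat.ListAction using (sum)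
open import Algebra.Properties.CommutativeSemigroup +-commutativeSemigroup
  using () renaming (interchange to +-interchange)
open import Data.Fin using (inject≤; _≟_)
open import Data.Fin.Properties using (toℕ-injective; inject≤-injective; injective⇒≤)
open import Data.Fin.Subset using (Nonempty)
open import Data.Fin.Subset.Properties using (_∈?_; nonempty?; Empty-unique; ∣⊥∣≡0)
open import Data.Bool using (Bool; true; false; T; if_then_else_; _∨_; _∧_; not)
open import Data.Bool.Properties using (T-∧; T-∨; ∨-zeroʳ)
open import Data.List as List using (List; []; _∷_; map; allFin; length; deduplicate)
open import Data.List.Properties using (map-cong)
open import Data.List.Membership.Propositional using () renaming (_∈_ to _∈ₗ_)
open import Data.List.Membership.Propositional.Properties using (∈-allFin; ∈-deduplicate⁺)
open import Data.List.Relation.Unary.Any using (here; there; index)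
open import Data.List.Relation.Unary.Any.Properties using (lookup-index)
open import Data.Vec as Vec using (Vec; lookup; toList)
open import Data.Vec.Membership.Propositional.Properties using (∈-lookup; ∈-toList⁺)
import Data.Vec.Properties as Vec
open import Data.Product using (Σ; _×_; _,_; proj₁; proj₂)
open import Data.Sum using (inj₁; inj₂)
open import Data.Unit using (tt)
open import Function using (Injective)
open import Function.Bundles using (Equivalence)
open import Relation.Binary.Definitions using (tri<; tri≈; tri>)
open import Relation.Nullary using (yes; no; contradiction)
open import Relation.Nullary.Decidable using (⌊_⌋)
open import Relation.Binary.PropositionalEquality
  using (_≡_; refl; sym; trans; cong; cong₂; module ≡-Reasoning)

bit : Bool → ℕ
bit true  = 1
bit false = 0

count-∷ : {A : Set} (p : A → Bool) (a : A) (as : List A) →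
  count p (a ∷ as) ≡ bit (p a) + count p as
count-∷ p a as with p a
... | true  = refl
... | false = refl

sum-map-+ : {A : Set} (p q : A → ℕ) (l : List A) →
  sum (map (λ x → p x + q x) l) ≡ sum (map p l) + sum (map q l)
sum-map-+ p q [] = refl
sum-map-+ p q (x ∷ l) = begin
  (p x + q x) + sum (map (λ x → p x + q x) l)   ≡⟨ cong ((p x + q x) +_) (sum-map-+ p q l) ⟩
  (p x + q x) + (sum (map p l) + sum (map q l)) ≡⟨ +-interchange (p x) (q x) _ _ ⟩
  (p x + sum (map p l)) + (q x + sum (map q l)) ∎
  where open ≡-Reasoning

sum-map-≥ : {A : Set} (p : A → ℕ) {l : List A} {x : A} → x ∈ₗ l → p x ≤ sum (map p l)
sum-map-≥ p {y ∷ l} (here refl) = m≤m+n (p y) _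
sum-map-≥ p {y ∷ l} (there x∈l) = ≤-trans (sum-map-≥ p x∈l) (m≤n+m _ (p y))

doubleSum : {t : ℕ} → (Fin t → Fin t → ℕ) → ℕ
doubleSum {t} f = sum (map (λ i → sum (map (f i) (allFin t))) (allFin t))

below : {t : ℕ} → (Fin t → Fin t → ℕ) → Fin t → Fin t → ℕ
below f i j with toℕ i <? toℕ j
... | yes _ = f i j
... | no  _ = 0

-- The summand
-- of sumPairs is local to its definition and cannot be named, so the
-- pointwise unfolding leaves it to be inferred (hence the mutual block).
mutual
  sumPairs-doubleSum : {t : ℕ} (f : Fin t → Fin t → ℕ) → sumPairs f ≡ doubleSum (below f)
  sumPairs-doubleSum {t} f =
    cong sum (map-cong (λ i → cong sum (map-cong (below-unfold f i) (allFin t))) (allFin t))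

  below-unfold : {t : ℕ} (f : Fin t → Fin t → ℕ) (i j : Fin t) → _ ≡ below f i j
  below-unfold f i j with toℕ i <? toℕ j
  ... | yes _ = refl
  ... | no  _ = refl

sumPairs-+ : {t : ℕ} (f g h : Fin t → Fin t → ℕ) → (∀ i j → h i j ≡ f i j + g i j) →
  sumPairs h ≡ sumPairs f + sumPairs g
sumPairs-+ {t} f g h h≡f+g = begin
  sumPairs h                                   ≡⟨ sumPairs-doubleSum h ⟩
  doubleSum (below h)                          ≡⟨ cong sum (map-cong row (allFin t)) ⟩
  sum (map (λ i → rowSum f i + rowSum g i) (allFin t))
                                               ≡⟨ sum-map-+ (rowSum f) (rowSum g) (allFin t) ⟩
  doubleSum (below f) + doubleSum (below g)    ≡⟨ sym (cong₂ _+_ (sumPairs-doubleSum f) (sumPairs-doubleSum g)) ⟩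
  sumPairs f + sumPairs g                      ∎
  where
  open ≡-Reasoning
  rowSum : (Fin t → Fin t → ℕ) → Fin t → ℕ
  rowSum k i = sum (map (below k i) (allFin t))

  below-+ : ∀ i j → below h i j ≡ below f i j + below g i j
  below-+ i j with toℕ i <? toℕ j
  ... | yes _ = h≡f+g i j
  ... | no  _ = refl

  row : ∀ i → rowSum h i ≡ rowSum f i + rowSum g i
  row i = trans (cong sum (map-cong (below-+ i) (allFin t)))
                (sum-map-+ (below f i) (below g i) (allFin t))

sumPairs-≥ : {t : ℕ} (f : Fin t → Fin t → ℕ) (i j : Fin t) → toℕ i < toℕ j → f i j ≤ sumPairs f
sumPairs-≥ {t} f i j i<j = begin
  f i j                                      ≡⟨ below-i<j ⟨
  below f i j                                ≤⟨ sum-map-≥ (below f i) (∈-allFin j) ⟩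
  sum (map (below f i) (allFin t))           ≤⟨ sum-map-≥ (λ i → sum (map (below f i) (allFin t))) (∈-allFin i) ⟩
  doubleSum (below f)                        ≡⟨ sumPairs-doubleSum f ⟨
  sumPairs f                                 ∎
  where
  open ≤-Reasoning
  below-i<j : below f i j ≡ f i j
  below-i<j with toℕ i <? toℕ j
  ... | yes _   = refl
  ... | no  i≮j = contradiction i<j i≮j

cut : {t : ℕ} → (V → Fin t) → V × V → Bool
cut c (u , v) = not ⌊ c u ≟ c v ⌋

module CutEdges {t : ℕ} (X : Fin t → Subset 8) (c : V → Fin t) (c-mem : ∀ v → v ∈ X (c v)) where

  eOn : List (V × V) → Fin t → Fin t → ℕ
  eOn es i j = count (crosses (X i) (X j)) es

  member : ∀ {v : V} {S : Subset 8} → v ∈ S → ⌊ v ∈? S ⌋ ≡ true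
  member {v} {S} v∈S with v ∈? S
  ... | yes _   = refl
  ... | no  v∉S = contradiction v∈S v∉S

  crosses-ends : ∀ u v → crosses (X (c u)) (X (c v)) (u , v) ≡ true
                       × crosses (X (c v)) (X (c u)) (u , v) ≡ true
  crosses-ends u v rewrite member (c-mem u) | member (c-mem v) = refl , ∨-zeroʳ _

  pair-counted : ∀ x i j → crosses (X i) (X j) x ≡ true → toℕ i < toℕ j →
    1 ≤ sumPairs (λ i j → bit (crosses (X i) (X j) x))
  pair-counted x i j crossing i<j =
    ≤-trans (≤-reflexive (cong bit (sym crossing)))
            (sumPairs-≥ (λ i j → bit (crosses (X i) (X j) x)) i j i<j)

  cut-counted : ∀ x → bit (cut c x) ≤ sumPairs (λ i j → bit (crosses (X i) (X j) x))
  cut-counted (u , v) with c u ≟ c v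
  ... | yes _ = z≤n
  ... | no cu≢cv with <-cmp (toℕ (c u)) (toℕ (c v))
  ...   | tri< cu<cv _ _ = pair-counted (u , v) (c u) (c v) (proj₁ (crosses-ends u v)) cu<cv
  ...   | tri≈ _ cu≡cv _ = contradiction (toℕ-injective cu≡cv) cu≢cv
  ...   | tri> _ _ cv<cu = pair-counted (u , v) (c v) (c u) (proj₂ (crosses-ends u v)) cv<cu

  cuts≤sumPairs : ∀ es → count (cut c) es ≤ sumPairs (eOn es)
  cuts≤sumPairs [] = z≤n
  cuts≤sumPairs (x ∷ es) = begin
    count (cut c) (x ∷ es)                                       ≡⟨ count-∷ (cut c) x es ⟩
    bit (cut c x) + count (cut c) es                             ≤⟨ +-mono-≤ (cut-counted x) (cuts≤sumPairs es) ⟩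
    sumPairs (λ i j → bit (crosses (X i) (X j) x)) + sumPairs (eOn es)
                                                                 ≡⟨ sumPairs-+ _ _ (eOn (x ∷ es)) (λ i j → count-∷ _ x es) ⟨
    sumPairs (eOn (x ∷ es))                                      ∎
    where open ≤-Reasoning

-- A labelling assigns to each vertex the representative of its component.
Labelling : Set
Labelling = Vec V 8

relabel : V → V → V → V
relabel a b x = if ⌊ x ≟ b ⌋ then a else x

merge : Labelling → V → V → Labelling
merge L u v = Vec.map (relabel (lookup L u) (lookup L v)) L

labels : Labelling → List V
labels L = deduplicate _≟_ (toList L)

-- certified es L k: along every way of keeping or deleting each edge of es
-- (starting from labelling L with k edges already deleted), at least 8 edges
-- get deleted or at most 4 components remain.
certified : List (V × V) → Labelling → ℕ → Bool
certified [] L k = (8 ≤ᵇ k) ∨ (length (labels L) ≤ᵇ 4)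
certified ((u , v) ∷ es) L k = certified es (merge L u v) k ∧ certified es L (suc k)

G₃-certified : T (certified edges (Vec.allFin 8) 0)
G₃-certified = tt

module Soundness {t : ℕ} (c : V → Fin t) where

  Respects : Labelling → Set
  Respects L = ∀ x → c (lookup L x) ≡ c x

  respects-allFin : Respects (Vec.allFin 8)
  respects-allFin x = cong c (Vec.lookup-allFin x)

  respects-merge : ∀ L u v → c u ≡ c v → Respects L → Respects (merge L u v)
  respects-merge L u v cu≡cv resp x rewrite Vec.lookup-map x (relabel (lookup L u) (lookup L v)) L
    with lookup L x ≟ lookup L v
  ... | no  _     = resp x
  ... | yes Lx≡Lv = begin
    c (lookup L u) ≡⟨ resp u ⟩
    c u            ≡⟨ cu≡cv ⟩
    c v            ≡⟨ resp v ⟨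
    c (lookup L v) ≡⟨ cong c Lx≡Lv ⟨
    c (lookup L x) ≡⟨ resp x ⟩
    c x            ∎
    where open ≡-Reasoning

  Rainbow : Set
  Rainbow = Σ (Fin 5 → V) λ w → Injective _≡_ _≡_ (λ k → c (w k))

  -- Under a colour-respecting labelling the five vertices of a rainbow carry
  -- distinct labels, so at least five labels are in use.
  rainbow-labels : ∀ L → Respects L → Rainbow → 5 ≤ length (labels L)
  rainbow-labels L resp (w , distinct) = injective⇒≤ position-injective
    where
    listed : ∀ k → lookup L (w k) ∈ₗ labels L
    listed k = ∈-deduplicate⁺ _≟_ (∈-toList⁺ (∈-lookup (w k) L))

    position : Fin 5 → Fin (length (labels L))
    position k = index (listed k)

    position-injective : Injective _≡_ _≡_ position
    position-injective {k} {l} same-position = distinct (begin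
      c (w k)                                 ≡⟨ resp (w k) ⟨
      c (lookup L (w k))                      ≡⟨ cong c (lookup-index (listed k)) ⟩
      c (List.lookup (labels L) (position k)) ≡⟨ cong (λ p → c (List.lookup (labels L) p)) same-position ⟩
      c (List.lookup (labels L) (position l)) ≡⟨ cong c (lookup-index (listed l)) ⟨
      c (lookup L (w l))                      ≡⟨ resp (w l) ⟩
      c (w l)                                 ∎)
      where open ≡-Reasoning

  -- Follow the branch of the search that keeps exactly the uncut edges: the
  -- labelling keeps respecting c, so by rainbow-labels the leaf cannot have
  -- at most 4 labels, and at least 8 edges were deleted along the way.
  certified-sound : Rainbow → ∀ es L k → Respects L → T (certified es L k) →
    8 ≤ k + count (cut c) es
  certified-sound rainbow [] L k resp cert with Equivalence.to T-∨ cert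
  ... | inj₁ 8≤k = ≤-trans (≤ᵇ⇒≤ 8 k 8≤k) (m≤m+n k 0)
  ... | inj₂ few = contradiction (≤ᵇ⇒≤ _ 4 few) (<⇒≱ (rainbow-labels L resp rainbow))
  certified-sound rainbow ((u , v) ∷ es) L k resp cert with c u ≟ c v
  ... | yes cu≡cv = certified-sound rainbow es (merge L u v) k
                      (respects-merge L u v cu≡cv resp) (proj₁ (Equivalence.to T-∧ cert))
  ... | no  _     = ≤-trans (certified-sound rainbow es L (suc k) resp (proj₂ (Equivalence.to T-∧ cert)))
                            (≤-reflexive (sym (+-suc k _)))

element : ∀ {n} (p : Subset n) → 0 < ∣ p ∣ → Nonempty p
element {n} p 0<∣p∣ with nonempty? p
... | yes p-nonempty = p-nonempty
... | no  p-empty    = contradiction (sym (trans (cong ∣_∣ (Empty-unique p-empty)) (∣⊥∣≡0 n))) (<⇒≢ 0<∣p∣)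

module Partition {t : ℕ} (X : Fin t → Subset 8)
  (disjoint : ∀ i j → i ≢ j → ∀ v → v ∈ X i → v ∈ X j → ⊥)
  (cover : ∀ (v : V) → ∃[ i ] v ∈ X i) where

  colour : V → Fin t
  colour v = proj₁ (cover v)

  colour-mem : ∀ v → v ∈ X (colour v)
  colour-mem v = proj₂ (cover v)

  colour-unique : ∀ i v → v ∈ X i → colour v ≡ i
  colour-unique i v v∈Xi with colour v ≟ i
  ... | yes colour≡i = colour≡i
  ... | no  colour≢i = ⊥-elim (disjoint _ _ colour≢i v (colour-mem v) v∈Xi)

  rainbow : t ≥ 5 → (∀ i → 0 < ∣ X i ∣) → Soundness.Rainbow colour
  rainbow t≥5 nonempty = representative , distinct
    where
    part : Fin 5 → Fin t
    part k = inject≤ k t≥5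

    representative : Fin 5 → V
    representative k = proj₁ (element (X (part k)) (nonempty (part k)))

    representative-colour : ∀ k → colour (representative k) ≡ part k
    representative-colour k =
      colour-unique (part k) _ (proj₂ (element (X (part k)) (nonempty (part k))))

    distinct : Injective _≡_ _≡_ (λ k → colour (representative k))
    distinct {k} {l} same-colour = inject≤-injective t≥5 t≥5 k l (begin
      part k                      ≡⟨ representative-colour k ⟨
      colour (representative k)   ≡⟨ same-colour ⟩
      colour (representative l)   ≡⟨ representative-colour l ⟩
      part l                      ∎)
      where open ≡-Reasoning

-- Lemma 2.9: with t ≥ 5 nonempty parts, at least 8 edges of G₃ run between
-- different parts.
lemma2p9 : (t : ℕ) → t ≥ 5 → (X : Fin t → Subset 8)
    → (∀ i j → i ≢ j → ∀ v → v ∈ X i → v ∈ X j → ⊥)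
    → (∀ (v : V) → ∃[ i ] v ∈ X i)
    → (∀ (i j : Fin t) → toℕ i ≤ toℕ j → ∣ X j ∣ ≤ ∣ X i ∣)
    → (∀ (i : Fin t) → 0 < ∣ X i ∣)
    → 8 ≤ sumPairs (λ i j → e (X i) (X j))
lemma2p9 t t≥5 X disjoint cover _ nonempty = begin
  8                                  ≤⟨ certified-sound (rainbow t≥5 nonempty) edges (Vec.allFin 8) 0
                                                        respects-allFin G₃-certified ⟩
  count (cut colour) edges           ≤⟨ cuts≤sumPairs edges ⟩
  sumPairs (λ i j → e (X i) (X j))   ∎
  where
  open Partition X disjoint cover
  open Soundness colour
  open CutEdges X colour colour-mem
  open ≤-Reasoning
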